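{- Let $G=(V,E)$ be a directed graph with $n=|V|$ nodes, $s\ne t$ in $V$, that is minimally $k$-$st$-edge-connected. Then there exists an ordering $s=v_1,\ldots,v_n=t$ of $V$ such that for every $i\le n-1$, the set $C_i=\{v_1,\ldots,v_i\}$ is a minimum $st$-cut of $G$ and no edge of $G$ enters $C_i$.
   Context: $G$ is minimally $k$-$st$-edge-connected if $G$ contains $k$ pairwise edge-disjoint directed $st$-paths but no proper subgraph of $G$ does. An $st$-cut is a set $R\subseteq V$ with $s\in R$, $t\notin R$; its value is $d^{\sf out}_G(R)$, the number of edges leaving $R$ (tail in $R$, head outside $R$), and a minimum $st$-cut is one of minimum value. An edge enters $R$ if its head is in $R$ and its tail is outside $R$. -}

module Defs where

open import Data.Nat using (ℕ; zero; suc; _+_; _≤_; _<ᵇ_)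
open import Data.Bool using (Bool; true; false; _∧_; not; if_then_else_)
open import Data.Fin using (Fin; toℕ)
open import Data.Fin.Subset using (Subset; _∈_; _∉_)
open import Data.Fin.Permutation using (Permutation′; _⟨$⟩ˡ_)
open import Data.List using (List; []; _∷_; map; allFin)
open import Data.Nat.ListAction using (sum)
open import Data.List.Relation.Unary.Unique.Propositional using (Unique)
import Data.List.Membership.Propositional as LM
open import Data.Vec using (lookup; tabulate)
open import Data.Product using (Σ; _×_; _,_; proj₁; proj₂; ∃)
open import Relation.Binary.PropositionalEquality using (_≡_)
open import Relation.Nullary using (¬_)

-- A directed multigraph on vertex set Fin n with m edges (parallel edges and
-- loops allowed); edge e goes from tail (proj₁ (E e)) to head (proj₂ (E e)).
Graph : ℕ → ℕ → Set
Graph n m = Fin m → Fin n × Fin n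

module _ {n m : ℕ} (E : Graph n m) where

  tl hd : Fin m → Fin n
  tl e = proj₁ (E e)
  hd e = proj₂ (E e)

  data Walk : Fin n → Fin n → Set where
    []  : ∀ {u} → Walk u u
    _∷⟨_⟩_ : ∀ {u v} (e : Fin m) → tl e ≡ u → Walk (hd e) v → Walk u v

  verts : ∀ {u v} → Walk u v → List (Fin n)
  verts {u} []             = u ∷ []
  verts {u} (e ∷⟨ _ ⟩ w)   = u ∷ verts w

  edgesOf : ∀ {u v} → Walk u v → List (Fin m)
  edgesOf []             = []
  edgesOf (e ∷⟨ _ ⟩ w)   = e ∷ edgesOf w

  Path : Fin n → Fin n → Set
  Path u v = Σ (Walk u v) λ w → Unique (verts w)

  HasDisjointPaths : (s t : Fin n) (k : ℕ) (S : Subset m) → Set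
  HasDisjointPaths s t k S =
    Σ (Fin k → Path s t) λ P →
      (∀ i e → e LM.∈ edgesOf (proj₁ (P i)) → e ∈ S) ×
      (∀ i j e → e LM.∈ edgesOf (proj₁ (P i)) → e LM.∈ edgesOf (proj₁ (P j)) → i ≡ j)

  allEdges : Subset m
  allEdges = tabulate (λ _ → true)

  MinimallyKStEdgeConnected : (s t : Fin n) (k : ℕ) → Set
  MinimallyKStEdgeConnected s t k =
    HasDisjointPaths s t k allEdges ×
    (∀ (S : Subset m) → (∃ λ e → e ∉ S) → ¬ HasDisjointPaths s t k S)

  leavesᵇ : Subset n → Fin m → Bool
  leavesᵇ R e = lookup R (tl e) ∧ not (lookup R (hd e))

  dout : Subset n → ℕ
  dout R = sum (map (λ e → if leavesᵇ R e then 1 else 0) (allFin m))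

  IsStCut : (s t : Fin n) → Subset n → Set
  IsStCut s t R = s ∈ R × t ∉ R

  IsMinStCut : (s t : Fin n) → Subset n → Set
  IsMinStCut s t R = IsStCut s t R × (∀ R' → IsStCut s t R' → dout R ≤ dout R')

  Enters : Subset n → Fin m → Set
  Enters R e = hd e ∈ R × tl e ∉ R

-- for an ordering π (position ↦ vertex, 0-indexed) the prefix set
-- C_i = {v_1, …, v_i} = vertices at positions < i
prefix : ∀ {n} → Permutation′ n → ℕ → Subset n
prefix π i = tabulate (λ v → toℕ (π ⟨$⟩ˡ v) <ᵇ i)

-- By minimality every edge lies on one of the k given edge-disjoint st-paths, so no edge
-- enters s or leaves t, and the paths partition the edge set. The graph is acyclic: deleting
-- the edges of a cycle leaves a flow of value k, which decomposes into k edge-disjoint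
-- st-walks, hence paths, avoiding an edge, against minimality. Ordering the vertices by
-- decreasing length of a longest walk leaving them, with s first and t last, makes every
-- edge point forward, so no edge enters a prefix C_i. An st-path leaves every st-cut at
-- least once, and leaves a cut that no edge enters exactly once; hence d^out(R) ≥ k for
-- every st-cut R, with equality for each C_i.

module Submission where

open import Defs
open import Data.Bool using (Bool; true; false; T; not; _∧_; if_then_else_)
open import Data.Bool.Properties using (T-≡)
open import Data.Empty using (⊥-elim)
open import Data.Fin using (Fin; zero; suc; toℕ; fromℕ<; punchOut)
import Data.Fin.Properties as Fin
open import Data.Fin.Permutation using (Permutation′; permutation; _⟨$⟩ˡ_)
open import Data.Fin.Subset using (Subset)
import Data.Fin.Subset as Subset
open import Data.List using (List; []; _∷_; length; map)
import Data.List.Base as List using (lookup; tabulate)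
import Data.Nat.ListAction as List
open import Data.List.Membership.Propositional using (_∈_; _∉_)
open import Data.List.Membership.Propositional.Properties using (∈-lookup)
open import Data.List.Relation.Binary.Subset.Propositional using (_⊆_)
open import Data.List.Relation.Unary.All using ([])
open import Data.List.Relation.Unary.All.Properties using (All¬⇒¬Any; ¬Any⇒All¬)
open import Data.List.Relation.Unary.AllPairs using ([]; _∷_)
open import Data.List.Relation.Unary.Any using (here; there)
open import Data.List.Relation.Unary.Unique.Propositional using (Unique)
open import Data.Nat using (ℕ; zero; suc; _+_; _*_; _≤_; _<_; _<ᵇ_; z≤n; s≤s; s≤s⁻¹)
open import Data.Nat.Properties
open import Algebra.Properties.Semiring.Sum +-*-semiring
  using (sum; sum-syntax; ∑-distrib-+; ∑-comm; sum-cong-≗; *-distribʳ-sum)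
open import Data.Nat.Tactic.RingSolver using (solve-∀)
open import Data.Product using (Σ; ∃; _×_; _,_; proj₁; proj₂)
open import Data.Sum using (_⊎_; inj₁; inj₂)
open import Data.Vec using (lookup; tabulate)
open import Data.Vec.Properties using (lookup∘tabulate; []=⇒lookup; lookup⇒[]=)
open import Function using (_∘_; id; case_of_; Equivalence)
open import Relation.Binary using (tri<; tri≈; tri>)
open import Relation.Binary.PropositionalEquality
open import Relation.Nullary using (¬_; does; yes; no)
open import Relation.Nullary.Decidable using (⌊_⌋; _×-dec_; T?; dec-true; dec-false; toWitness; fromWitness)

-- Indicator sums over Fin

𝟙 : Bool → ℕ
𝟙 b = if b then 1 else 0

𝟙-T : ∀ {b} → T b → 𝟙 b ≡ 1
𝟙-T {true} _ = refl

¬T⇒≡false : ∀ {b} → ¬ T b → b ≡ false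
¬T⇒≡false {false} _ = refl
¬T⇒≡false {true}  b̸ = ⊥-elim (b̸ _)

𝟙-mono : ∀ {a b} → (T a → T b) → 𝟙 a ≤ 𝟙 b
𝟙-mono {false} _   = z≤n
𝟙-mono {true}  a⇒b = ≤-reflexive (sym (𝟙-T (a⇒b _)))

𝟙-¬T : ∀ {b} → ¬ T b → 𝟙 b ≡ 0
𝟙-¬T = cong 𝟙 ∘ ¬T⇒≡false

∑-mono-≤ : ∀ {n} {f g : Fin n → ℕ} → (∀ i → f i ≤ g i) → sum f ≤ sum g
∑-mono-≤ {zero}  f≤g = z≤n
∑-mono-≤ {suc n} f≤g = +-mono-≤ (f≤g zero) (∑-mono-≤ (f≤g ∘ suc))

∑-mono-< : ∀ {n} {f g : Fin n → ℕ} → (∀ i → f i ≤ g i) → ∀ i → f i < g i → sum f < sum g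
∑-mono-< {suc n} f≤g zero    f<g = +-mono-<-≤ f<g (∑-mono-≤ (f≤g ∘ suc))
∑-mono-< {suc n} f≤g (suc i) f<g = +-mono-≤-< (f≤g zero) (∑-mono-< (f≤g ∘ suc) i f<g)

∑-const : ∀ {n} c → ∑[ i < n ] c ≡ n * c
∑-const {zero}  c = refl
∑-const {suc n} c = cong (c +_) (∑-const {n} c)

∑-pointed : ∀ {n} (f : Fin n → ℕ) (i : Fin n) → (∀ j → j ≢ i → f j ≡ 0) → sum f ≡ f i
∑-pointed {suc n} f zero f≡0 = begin
  f zero + sum (f ∘ suc)  ≡⟨ cong (f zero +_) (sum-cong-≗ (λ j → f≡0 (suc j) λ ())) ⟩
  f zero + ∑[ j < n ] 0   ≡⟨ cong (f zero +_) (trans (∑-const {n} 0) (*-zeroʳ n)) ⟩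
  f zero + 0              ≡⟨ +-identityʳ (f zero) ⟩
  f zero                  ∎
  where open ≡-Reasoning
∑-pointed {suc n} f (suc i) f≡0 =
  cong₂ _+_ (f≡0 zero λ ()) (∑-pointed (f ∘ suc) i (λ j j≢i → f≡0 (suc j) (j≢i ∘ Fin.suc-injective)))

∑-positive : ∀ {n} (f : Fin n → ℕ) → 0 < sum f → ∃ λ i → 0 < f i
∑-positive {suc n} f 0<∑ with f zero in eq
... | suc _ = zero , subst (0 <_) (sym eq) (s≤s z≤n)
... | zero  with ∑-positive (f ∘ suc) 0<∑
...   | i , 0<fi = suc i , 0<fi

δ : ∀ {n} → Fin n → Fin n → ℕ
δ i j = 𝟙 (does (i Fin.≟ j))

δ-diag : ∀ {n} (i : Fin n) → δ i i ≡ 1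
δ-diag i = cong 𝟙 (dec-true (i Fin.≟ i) refl)

δ-≢ : ∀ {n} {i j : Fin n} → i ≢ j → δ i j ≡ 0
δ-≢ {i = i} {j} i≢j = cong 𝟙 (dec-false (i Fin.≟ j) i≢j)

𝟙*δ-positive : ∀ {n b} {i j : Fin n} → 0 < 𝟙 b * δ i j → T b × i ≡ j
𝟙*δ-positive {b = true} {i} {j} positive with i Fin.≟ j
... | yes i≡j = _ , i≡j

∑-δ : ∀ {n} (i : Fin n) (g : Fin n → ℕ) → ∑[ j < n ] (δ i j * g j) ≡ g i
∑-δ i g = trans (∑-pointed _ i (λ j j≢i → cong (_* g j) (δ-≢ (j≢i ∘ sym))))
                (trans (cong (_* g i) (δ-diag i)) (+-identityʳ (g i)))

sumOver : ∀ {m} → (Fin m → Bool) → (Fin m → ℕ) → ℕ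
sumOver {m} R g = ∑[ e < m ] (𝟙 (R e) * g e)

infixl 10 sumOver
syntax sumOver R (λ e → g) = ∑[ e ∈ R ] g

∑∈-insert : ∀ {m} {R S : Fin m → Bool} (x : Fin m) → (∀ e → 𝟙 (R e) ≡ δ x e + 𝟙 (S e)) →
            ∀ g → ∑[ e ∈ R ] g e ≡ g x + ∑[ e ∈ S ] g e
∑∈-insert {m} {R} {S} x R≡x+S g = begin
  ∑[ e < m ] (𝟙 (R e) * g e)                          ≡⟨ sum-cong-≗ (λ e → cong (_* g e) (R≡x+S e)) ⟩
  ∑[ e < m ] ((δ x e + 𝟙 (S e)) * g e)                ≡⟨ sum-cong-≗ (λ e → *-distribʳ-+ (g e) (δ x e) _) ⟩
  ∑[ e < m ] (δ x e * g e + 𝟙 (S e) * g e)            ≡⟨ ∑-distrib-+ (λ e → δ x e * g e) _ ⟩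
  ∑[ e < m ] (δ x e * g e) + ∑[ e ∈ S ] g e           ≡⟨ cong (_+ ∑[ e ∈ S ] g e) (∑-δ x g) ⟩
  g x + ∑[ e ∈ S ] g e                                ∎
  where open ≡-Reasoning

∑-split : ∀ {m} (R : Fin m → Bool) (g : Fin m → ℕ) → sum g ≡ ∑[ e ∈ not ∘ R ] g e + ∑[ e ∈ R ] g e
∑-split R g = trans (sum-cong-≗ (λ e → split (R e) (g e))) (∑-distrib-+ (λ e → 𝟙 (not (R e)) * g e) _)
  where
  split : ∀ b x → x ≡ 𝟙 (not b) * x + 𝟙 b * x
  split true  x = sym (+-identityʳ x)
  split false x = sym (trans (+-identityʳ (x + 0)) (+-identityʳ x))

∑-partition : ∀ {m k} (R : Fin k → Fin m → Bool) → (∀ e → ∑[ i < k ] 𝟙 (R i e) ≡ 1) →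
              ∀ g → sum g ≡ ∑[ i < k ] ∑[ e ∈ R i ] g e
∑-partition {m} {k} R covers g = begin
  ∑[ e < m ] g e                              ≡⟨ sum-cong-≗ (λ e → *-identityˡ (g e)) ⟨
  ∑[ e < m ] (1 * g e)                        ≡⟨ sum-cong-≗ (λ e → cong (_* g e) (covers e)) ⟨
  ∑[ e < m ] (∑[ i < k ] 𝟙 (R i e) * g e)    ≡⟨ sum-cong-≗ (λ e → *-distribʳ-sum (g e) (λ i → 𝟙 (R i e))) ⟩
  ∑[ e < m ] ∑[ i < k ] (𝟙 (R i e) * g e)    ≡⟨ ∑-comm (λ e i → 𝟙 (R i e) * g e) ⟩
  ∑[ i < k ] ∑[ e ∈ R i ] g e                 ∎
  where open ≡-Reasoning

module _ {m : ℕ} where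
  open import Data.List.Membership.DecPropositional (Fin._≟_ {m}) using (_∈?_)

  _∈ᵇ_ : Fin m → List (Fin m) → Bool
  e ∈ᵇ xs = does (e ∈? xs)

  ∑∈-unique : ∀ {xs : List (Fin m)} → Unique xs → ∀ g → ∑[ e ∈ (_∈ᵇ xs) ] g e ≡ List.sum (map g xs)
  ∑∈-unique {[]}     []              g = trans (∑-const {m} 0) (*-zeroʳ m)
  ∑∈-unique {x ∷ xs} (x∉xs ∷ unique) g =
    trans (∑∈-insert x split g) (cong (g x +_) (∑∈-unique unique g))
    where
    split : ∀ e → 𝟙 (e ∈ᵇ (x ∷ xs)) ≡ δ x e + 𝟙 (e ∈ᵇ xs)
    split e with e Fin.≟ x
    ... | yes refl = sym (cong₂ _+_ (δ-diag x) (cong 𝟙 (dec-false (x ∈? xs) (All¬⇒¬Any x∉xs))))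
    ... | no e≢x   = sym (cong (_+ 𝟙 (e ∈ᵇ xs)) (δ-≢ (e≢x ∘ sym)))

  ∈⇒∈ᵇ : ∀ {e xs} → e ∈ xs → e ∈ᵇ xs ≡ true
  ∈⇒∈ᵇ {e} {xs} = dec-true (e ∈? xs)

  ∉⇒∈ᵇ : ∀ {e xs} → e ∉ xs → e ∈ᵇ xs ≡ false
  ∉⇒∈ᵇ {e} {xs} = dec-false (e ∈? xs)

sum-map-tabulate : ∀ {A : Set} {m} (h : A → ℕ) (g : Fin m → A) → List.sum (map h (List.tabulate g)) ≡ sum (h ∘ g)
sum-map-tabulate {m = zero}  h g = refl
sum-map-tabulate {m = suc m} h g = cong (h (g zero) +_) (sum-map-tabulate h (g ∘ suc))

-- Walks, paths and cycles

unique⇒length≤ : ∀ {n} {xs : List (Fin n)} → Unique xs → length xs ≤ n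
unique⇒length≤ unique = Fin.injective⇒≤ (lookup-injective unique)
  where
  lookup-injective : ∀ {ys : List (Fin _)} → Unique ys → ∀ {i j} → List.lookup ys i ≡ List.lookup ys j → i ≡ j
  lookup-injective (_ ∷ _)      {zero}  {zero}  _  = refl
  lookup-injective (y∉ys ∷ _)   {zero}  {suc j} eq = ⊥-elim (All¬⇒¬Any y∉ys (subst (_∈ _) (sym eq) (∈-lookup j)))
  lookup-injective (y∉ys ∷ _)   {suc i} {zero}  eq = ⊥-elim (All¬⇒¬Any y∉ys (subst (_∈ _) eq (∈-lookup i)))
  lookup-injective (_ ∷ unique) {suc i} {suc j} eq = cong suc (lookup-injective unique eq)

-- The largest j < b with T (p j), and 0 if there is none.
greatestBelow : (ℕ → Bool) → ℕ → ℕ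
greatestBelow p zero    = 0
greatestBelow p (suc b) = if p b then b else greatestBelow p b

module _ (p : ℕ → Bool) where

  greatestBelow-holds : T (p 0) → ∀ b → T (p (greatestBelow p b))
  greatestBelow-holds p0 zero = p0
  greatestBelow-holds p0 (suc b) with p b in pb
  ... | true  = subst T (sym pb) _
  ... | false = greatestBelow-holds p0 b

  greatestBelow-greatest : ∀ b {j} → T (p j) → j < b → j ≤ greatestBelow p b
  greatestBelow-greatest (suc b) {j} pj j<1+b with p b in pb | m≤n⇒m<n∨m≡n (s≤s⁻¹ j<1+b)
  ... | true  | _          = s≤s⁻¹ j<1+b
  ... | false | inj₁ j<b   = greatestBelow-greatest b pj j<b
  ... | false | inj₂ refl  = ⊥-elim (subst T pb pj)

module _ {n m : ℕ} (E : Graph n m) where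
  open import Data.List.Membership.DecPropositional (Fin._≟_ {n}) using (_∈?_)

  start∈verts : ∀ {u v} (w : Walk E u v) → u ∈ verts E w
  start∈verts []            = here refl
  start∈verts (_ ∷⟨ _ ⟩ _)  = here refl

  end∈verts : ∀ {u v} (w : Walk E u v) → v ∈ verts E w
  end∈verts []            = here refl
  end∈verts (_ ∷⟨ _ ⟩ w)  = there (end∈verts w)

  tl∈verts : ∀ {u v e} (w : Walk E u v) → e ∈ edgesOf E w → tl E e ∈ verts E w
  tl∈verts (_ ∷⟨ tl≡u ⟩ _) (here refl) = here tl≡u
  tl∈verts (_ ∷⟨ _ ⟩ w)    (there e∈w) = there (tl∈verts w e∈w)

  hd∈verts : ∀ {u v e} (w : Walk E u v) → e ∈ edgesOf E w → hd E e ∈ verts E w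
  hd∈verts (_ ∷⟨ _ ⟩ w) (here refl) = there (start∈verts w)
  hd∈verts (_ ∷⟨ _ ⟩ w) (there e∈w) = there (hd∈verts w e∈w)

  path-hd≢start : ∀ {u v e} (w : Walk E u v) → Unique (verts E w) → e ∈ edgesOf E w → hd E e ≢ u
  path-hd≢start (_ ∷⟨ _ ⟩ w) (u∉w ∷ _) (here refl) refl = All¬⇒¬Any u∉w (start∈verts w)
  path-hd≢start (_ ∷⟨ _ ⟩ w) (u∉w ∷ _) (there e∈w) refl = All¬⇒¬Any u∉w (hd∈verts w e∈w)

  path-tl≢end : ∀ {u v e} (w : Walk E u v) → Unique (verts E w) → e ∈ edgesOf E w → tl E e ≢ v
  path-tl≢end (_ ∷⟨ refl ⟩ w) (u∉w ∷ _) (here refl) refl = All¬⇒¬Any u∉w (end∈verts w)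
  path-tl≢end (_ ∷⟨ _ ⟩ w) (_ ∷ unique) (there e∈w) = path-tl≢end w unique e∈w

  path-edges-unique : ∀ {u v} (w : Walk E u v) → Unique (verts E w) → Unique (edgesOf E w)
  path-edges-unique []                 _            = []
  path-edges-unique (_ ∷⟨ refl ⟩ w) (u∉w ∷ unique) =
    ¬Any⇒All¬ _ (All¬⇒¬Any u∉w ∘ tl∈verts w) ∷ path-edges-unique w unique

  takeTo : ∀ {u v x} (w : Walk E u v) → x ∈ verts E w → Walk E u x
  takeTo []            (here refl) = []
  takeTo (_ ∷⟨ _ ⟩ _)  (here refl) = []
  takeTo (e ∷⟨ p ⟩ w)  (there x∈w) = e ∷⟨ p ⟩ takeTo w x∈w

  dropTo : ∀ {u v x} (w : Walk E u v) → x ∈ verts E w →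
           Σ (Walk E x v) λ w′ → (Unique (verts E w) → Unique (verts E w′)) × edgesOf E w′ ⊆ edgesOf E w
  dropTo []           (here refl) = [] , id , id
  dropTo w@(_ ∷⟨ _ ⟩ _) (here refl) = w , id , id
  dropTo (_ ∷⟨ _ ⟩ w) (there x∈w) with dropTo w x∈w
  ... | w′ , unique′ , ⊆w = w′ , (λ { (_ ∷ unique) → unique′ unique }) , there ∘ ⊆w

  shortcut : ∀ {u v} (w : Walk E u v) → Σ (Path E u v) λ p → edgesOf E (proj₁ p) ⊆ edgesOf E w
  shortcut [] = ([] , [] ∷ []) , id
  shortcut {u} (e ∷⟨ p ⟩ w) with shortcut w
  ... | (q , unique) , q⊆w with u ∈? verts E q
  ...   | yes u∈q = let (r , unique′ , r⊆q) = dropTo q u∈q in (r , unique′ unique) , there ∘ q⊆w ∘ r⊆q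
  ...   | no u∉q  = (e ∷⟨ p ⟩ q , ¬Any⇒All¬ _ u∉q ∷ unique) , λ where
    (here refl)  → here refl
    (there e′∈q) → there (q⊆w e′∈q)

  Cycle : Set
  Cycle = ∃ λ e → Walk E (hd E e) (tl E e)

  path-or-cycle : ∀ {u v} (w : Walk E u v) → Unique (verts E w) ⊎ Cycle
  path-or-cycle [] = inj₁ ([] ∷ [])
  path-or-cycle {u} (e ∷⟨ p ⟩ w) with path-or-cycle w
  ... | inj₂ cycle = inj₂ cycle
  ... | inj₁ unique with u ∈? verts E w
  ...   | yes u∈w = inj₂ (e , subst (Walk E (hd E e)) (sym p) (takeTo w u∈w))
  ...   | no u∉w  = inj₁ (¬Any⇒All¬ _ u∉w ∷ unique)

  hasWalkOfLength : ℕ → Fin n → Bool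
  hasWalkOfLength zero    v = true
  hasWalkOfLength (suc j) v = ⌊ Fin.any? (λ e → (tl E e Fin.≟ v) ×-dec T? (hasWalkOfLength j (hd E e))) ⌋

  hasWalkOfLength-sound : ∀ j v → T (hasWalkOfLength j v) → ∃ λ x → Σ (Walk E v x) λ w → length (verts E w) ≡ suc j
  hasWalkOfLength-sound zero    v _    = v , [] , refl
  hasWalkOfLength-sound (suc j) v walk with toWitness walk
  ... | e , tl≡v , walk′ with hasWalkOfLength-sound j (hd E e) walk′
  ...   | x , w , length≡ = x , e ∷⟨ tl≡v ⟩ w , cong suc length≡

  hasWalkOfLength-step : ∀ j e → T (hasWalkOfLength j (hd E e)) → T (hasWalkOfLength (suc j) (tl E e))
  hasWalkOfLength-step j e walk = fromWitness (e , refl , walk)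

  module _ (acyclic : ¬ Cycle) where

    hasWalkOfLength-bounded : ∀ j v → T (hasWalkOfLength j v) → j < n
    hasWalkOfLength-bounded j v walk with hasWalkOfLength-sound j v walk
    ... | _ , w , length≡ with path-or-cycle w
    ...   | inj₁ unique = subst (_≤ n) length≡ (unique⇒length≤ unique)
    ...   | inj₂ cycle  = ⊥-elim (acyclic cycle)

    depth : Fin n → ℕ
    depth v = greatestBelow (λ j → hasWalkOfLength j v) n

    depth-attained : ∀ v → T (hasWalkOfLength (depth v) v)
    depth-attained v = greatestBelow-holds (λ j → hasWalkOfLength j v) _ n

    depth<n : ∀ v → depth v < n
    depth<n v = hasWalkOfLength-bounded (depth v) v (depth-attained v)

    depth-decreasing : ∀ e → depth (hd E e) < depth (tl E e)
    depth-decreasing e =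
      greatestBelow-greatest (λ j → hasWalkOfLength j (tl E e)) n walk (hasWalkOfLength-bounded _ _ walk)
      where
      walk : T (hasWalkOfLength (suc (depth (hd E e))) (tl E e))
      walk = hasWalkOfLength-step (depth (hd E e)) e (depth-attained (hd E e))

-- Flows

EdgeDisjoint : ∀ {A : Set} {k} → (Fin k → List A) → Set
EdgeDisjoint L = ∀ i j e → e ∈ L i → e ∈ L j → i ≡ j

module _ {m : ℕ} where

  _─_ : (Fin m → Bool) → Fin m → Fin m → Bool
  (R ─ e) e′ = not (does (e Fin.≟ e′)) ∧ R e′

  ∑∈-remove : ∀ R {e} → T (R e) → ∀ g → ∑[ x ∈ R ] g x ≡ g e + ∑[ x ∈ R ─ e ] g x
  ∑∈-remove R {e} e∈R = ∑∈-insert e split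
    where
    split : ∀ e′ → 𝟙 (R e′) ≡ δ e e′ + 𝟙 ((R ─ e) e′)
    split e′ with e Fin.≟ e′
    ... | yes refl = trans (𝟙-T e∈R) (sym (+-identityʳ _))
    ... | no _     = refl

  ─-⊆ : ∀ {R e e′} → T ((R ─ e) e′) → T (R e′)
  ─-⊆ {R} {e} {e′} with does (e Fin.≟ e′)
  ... | false = id

  ─-removes : ∀ {R e} → ¬ T ((R ─ e) e)
  ─-removes {R} {e} rewrite dec-true (e Fin.≟ e) refl = λ ()

  size : (Fin m → Bool) → ℕ
  size R = ∑[ e ∈ R ] 1

module _ {n m : ℕ} (E : Graph n m) where

  outdeg indeg : (Fin m → Bool) → Fin n → ℕ
  outdeg R v = ∑[ e ∈ R ] δ (tl E e) v
  indeg  R v = ∑[ e ∈ R ] δ (hd E e) v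

  Balanced : (Fin m → Bool) → (supply demand : Fin n → ℕ) → Set
  Balanced R σ τ = ∀ v → outdeg R v + τ v ≡ indeg R v + σ v

  balanced-─ : ∀ {R} {σ τ : Fin n → ℕ} {u e} → T (R e) → tl E e ≡ u →
               Balanced R (λ v → σ v + δ u v) τ → Balanced (R ─ e) (λ v → σ v + δ (hd E e) v) τ
  balanced-─ {R} {σ} {τ} {e = e} e∈R refl balanced v = +-cancelˡ-≡ (δ (tl E e) v) _ _ (begin
    δ (tl E e) v + (outdeg (R ─ e) v + τ v)          ≡⟨ +-assoc (δ (tl E e) v) (outdeg (R ─ e) v) (τ v) ⟨
    δ (tl E e) v + outdeg (R ─ e) v + τ v            ≡⟨ cong (_+ τ v) (∑∈-remove R e∈R (λ x → δ (tl E x) v)) ⟨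
    outdeg R v + τ v                                 ≡⟨ balanced v ⟩
    indeg R v + (σ v + δ (tl E e) v)
      ≡⟨ cong (_+ (σ v + δ (tl E e) v)) (∑∈-remove R e∈R (λ x → δ (hd E x) v)) ⟩
    δ (hd E e) v + indeg (R ─ e) v + (σ v + δ (tl E e) v)
      ≡⟨ rearrange (δ (hd E e) v) (indeg (R ─ e) v) (σ v) (δ (tl E e) v) ⟩
    δ (tl E e) v + (indeg (R ─ e) v + (σ v + δ (hd E e) v)) ∎)
    where
    open ≡-Reasoning
    rearrange : ∀ a b c d → a + b + (c + d) ≡ d + (b + (c + a))
    rearrange = solve-∀

  module _ (t : Fin n) where

    record Carving (R : Fin m → Bool) (σ : Fin n → ℕ) (c : ℕ) (u : Fin n) : Set where
      field
        walk          : Walk E u t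
        rest          : Fin m → Bool
        rest-balanced : Balanced rest σ (λ v → c * δ t v)
        rest⊆R        : ∀ {e} → T (rest e) → T (R e)
        walk⊆R∖rest   : ∀ {e} → e ∈ edgesOf E walk → T (R e) × ¬ T (rest e)

    leaving-edge : ∀ {R} {σ τ : Fin n → ℕ} {u} → Balanced R (λ v → σ v + δ u v) τ → τ u ≡ 0 →
                   ∃ λ e → T (R e) × tl E e ≡ u
    leaving-edge {R} {σ} {τ} {u} balanced τu≡0 =
      let e , positive = ∑-positive (λ e → 𝟙 (R e) * δ (tl E e) u) 0<outdeg in e , 𝟙*δ-positive positive
      where
      0<outdeg : 0 < outdeg R u
      0<outdeg = begin-strict
        0                              <⟨ s≤s z≤n ⟩
        1                              ≤⟨ m≤n+m 1 (indeg R u + σ u) ⟩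
        indeg R u + σ u + 1            ≡⟨ cong (indeg R u + σ u +_) (δ-diag u) ⟨
        indeg R u + σ u + δ u u        ≡⟨ +-assoc (indeg R u) (σ u) (δ u u) ⟩
        indeg R u + (σ u + δ u u)      ≡⟨ balanced u ⟨
        outdeg R u + τ u               ≡⟨ cong (outdeg R u +_) τu≡0 ⟩
        outdeg R u + 0                 ≡⟨ +-identityʳ (outdeg R u) ⟩
        outdeg R u                     ∎
        where open ≤-Reasoning

    extend : ∀ {R σ c u e} → T (R e) → tl E e ≡ u → Carving (R ─ e) σ c (hd E e) → Carving R σ c u
    extend {R} {e = e} e∈R tl≡u carving = record
      { walk = e ∷⟨ tl≡u ⟩ walk ; rest = rest ; rest-balanced = rest-balanced
      ; rest⊆R = ─-⊆ {R = R} {e = e} ∘ rest⊆R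
      ; walk⊆R∖rest = λ where
          (here refl)  → e∈R , ─-removes {R = R} {e = e} ∘ rest⊆R
          (there e′∈w) → let e′∈R─e , e′∉rest = walk⊆R∖rest e′∈w in ─-⊆ {R = R} {e = e} e′∈R─e , e′∉rest }
      where open Carving carving

    -- Follow unused R-edges out of u, deleting them: away from t, the unit of supply at u
    -- forces an R-edge out of u, and size R bounds the number of steps.
    carve : ∀ b {R σ c u} → size R < b → Balanced R (λ v → σ v + δ u v) (λ v → suc c * δ t v) →
            Carving R σ c u
    carve (suc b) {R} {σ} {c} {u} size<b balanced with u Fin.≟ t
    ... | yes refl = record
      { walk = [] ; rest = R ; rest⊆R = id ; walk⊆R∖rest = λ ()
      ; rest-balanced = λ v → +-cancelʳ-≡ (δ u v) _ _ (begin
          outdeg R v + c * δ u v + δ u v    ≡⟨ rearrange (outdeg R v) _ _ ⟩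
          outdeg R v + (δ u v + c * δ u v)  ≡⟨ balanced v ⟩
          indeg R v + (σ v + δ u v)         ≡⟨ +-assoc (indeg R v) _ _ ⟨
          indeg R v + σ v + δ u v           ∎) }
      where
      open ≡-Reasoning
      rearrange : ∀ a x y → a + y + x ≡ a + (x + y)
      rearrange = solve-∀
    ... | no u≢t with leaving-edge balanced (trans (cong (suc c *_) (δ-≢ (u≢t ∘ sym))) (*-zeroʳ (suc c)))
    ...   | e , e∈R , tl≡u = extend e∈R tl≡u (carve b size<b′ (balanced-─ e∈R tl≡u balanced))
      where
      size<b′ : size (R ─ e) < b
      size<b′ = s≤s⁻¹ (subst (λ x → suc x ≤ suc b) (∑∈-remove R e∈R (λ _ → 1)) size<b)

  DisjointWalks : (s t : Fin n) (k : ℕ) (R : Fin m → Bool) → Set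
  DisjointWalks s t k R =
    Σ (Fin k → Walk E s t) λ W → (∀ i {e} → e ∈ edgesOf E (W i) → T (R e)) × EdgeDisjoint (edgesOf E ∘ W)

  decompose : ∀ {s t} j {R} → Balanced R (λ v → j * δ s v) (λ v → j * δ t v) → DisjointWalks s t j R
  decompose zero    _ = (λ ()) , (λ ()) , (λ ())
  decompose {s} {t} (suc j) {R} balanced = W , W⊆R , disjoint
    where
    carving : Carving t R (λ v → j * δ s v) j s
    carving = carve t (suc (size R)) ≤-refl λ v → trans (balanced v) (cong (indeg R v +_) (+-comm (δ s v) _))
    open Carving carving
    rest-decomposition : DisjointWalks s t j rest
    rest-decomposition = decompose j rest-balanced
    W′ : Fin j → Walk E s t
    W′ = proj₁ rest-decomposition
    W′⊆rest : ∀ i {e} → e ∈ edgesOf E (W′ i) → T (rest e)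
    W′⊆rest = proj₁ (proj₂ rest-decomposition)

    W : Fin (suc j) → Walk E s t
    W zero    = walk
    W (suc i) = W′ i

    W⊆R : ∀ i {e} → e ∈ edgesOf E (W i) → T (R e)
    W⊆R zero    = proj₁ ∘ walk⊆R∖rest
    W⊆R (suc i) = rest⊆R ∘ W′⊆rest i

    disjoint : EdgeDisjoint (edgesOf E ∘ W)
    disjoint zero    zero    e _ _ = refl
    disjoint zero    (suc i) e e∈walk e∈W′ = ⊥-elim (proj₂ (walk⊆R∖rest e∈walk) (W′⊆rest i e∈W′))
    disjoint (suc i) zero    e e∈W′ e∈walk = ⊥-elim (proj₂ (walk⊆R∖rest e∈walk) (W′⊆rest i e∈W′))
    disjoint (suc i) (suc i′) e e∈W′ e∈W′′ = cong suc (proj₂ (proj₂ rest-decomposition) i i′ e e∈W′ e∈W′′)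

  edgeSet : ∀ {u v} → Walk E u v → Fin m → Bool
  edgeSet w = _∈ᵇ edgesOf E w

  walk-balanced : ∀ {u v} (w : Walk E u v) → Unique (edgesOf E w) → Balanced (edgeSet w) (δ u) (δ v)
  walk-balanced {u} {v} w unique x = begin
    outdeg (edgeSet w) x + δ v x  ≡⟨ cong (_+ δ v x) (∑∈-unique unique (λ e → δ (tl E e) x)) ⟩
    outs w + δ v x                ≡⟨ along w ⟩
    ins w + δ u x                 ≡⟨ cong (_+ δ u x) (∑∈-unique unique (λ e → δ (hd E e) x)) ⟨
    indeg (edgeSet w) x + δ u x   ∎
    where
    open ≡-Reasoning
    outs ins : ∀ {u v} → Walk E u v → ℕ
    outs w = List.sum (map (λ e → δ (tl E e) x) (edgesOf E w))
    ins  w = List.sum (map (λ e → δ (hd E e) x) (edgesOf E w))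
    rearrange : ∀ a b c → a + (b + c) ≡ c + b + a
    rearrange = solve-∀
    along : ∀ {u v} (w : Walk E u v) → outs w + δ v x ≡ ins w + δ u x
    along []                      = refl
    along {v = v} (e ∷⟨ refl ⟩ w) = begin
      δ (tl E e) x + outs w + δ v x          ≡⟨ +-assoc (δ (tl E e) x) (outs w) (δ v x) ⟩
      δ (tl E e) x + (outs w + δ v x)        ≡⟨ cong (δ (tl E e) x +_) (along w) ⟩
      δ (tl E e) x + (ins w + δ (hd E e) x)  ≡⟨ rearrange (δ (tl E e) x) (ins w) (δ (hd E e) x) ⟩
      δ (hd E e) x + ins w + δ (tl E e) x    ∎

  complement-balanced : ∀ {Z} {σ τ ρ : Fin n → ℕ} →
    (∀ v → ∑[ e < m ] δ (tl E e) v + τ v ≡ ∑[ e < m ] δ (hd E e) v + σ v) →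
    Balanced Z ρ ρ → Balanced (not ∘ Z) σ τ
  complement-balanced {Z} {σ} {τ} {ρ} all-balanced Z-balanced v = +-cancelʳ-≡ (outdeg Z v) _ _ (begin
    outdeg (not ∘ Z) v + τ v + outdeg Z v   ≡⟨ rearrange (outdeg (not ∘ Z) v) (τ v) (outdeg Z v) ⟩
    outdeg (not ∘ Z) v + outdeg Z v + τ v   ≡⟨ cong (_+ τ v) (∑-split Z (λ e → δ (tl E e) v)) ⟨
    ∑[ e < m ] δ (tl E e) v + τ v           ≡⟨ all-balanced v ⟩
    ∑[ e < m ] δ (hd E e) v + σ v           ≡⟨ cong (_+ σ v) (∑-split Z (λ e → δ (hd E e) v)) ⟩
    indeg (not ∘ Z) v + indeg Z v + σ v     ≡⟨ rearrange (indeg (not ∘ Z) v) (indeg Z v) (σ v) ⟩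
    indeg (not ∘ Z) v + σ v + indeg Z v     ≡⟨ cong (indeg (not ∘ Z) v + σ v +_) Z-circulates ⟨
    indeg (not ∘ Z) v + σ v + outdeg Z v    ∎)
    where
    open ≡-Reasoning
    rearrange : ∀ a b c → a + b + c ≡ a + c + b
    rearrange = solve-∀
    Z-circulates : outdeg Z v ≡ indeg Z v
    Z-circulates = +-cancelʳ-≡ (ρ v) _ _ (Z-balanced v)

-- Crossing a cut

∉⇒lookup≡false : ∀ {n} (C : Subset n) {x} → x Subset.∉ C → lookup C x ≡ false
∉⇒lookup≡false C {x} x∉C with lookup C x in eq
... | true  = ⊥-elim (x∉C (lookup⇒[]= x C eq))
... | false = refl

module _ {n m : ℕ} (E : Graph n m) where

  PredecessorClosed : Subset n → Set
  PredecessorClosed C = ∀ e → lookup C (hd E e) ≡ true → lookup C (tl E e) ≡ true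

  crossings : ∀ {u v} → Subset n → Walk E u v → ℕ
  crossings C w = List.sum (map (𝟙 ∘ leavesᵇ E C) (edgesOf E w))

  crossings-positive : ∀ {u v} C (w : Walk E u v) → lookup C u ≡ true → lookup C v ≡ false → 1 ≤ crossings C w
  crossings-positive C [] u∈C v∉C with () ← trans (sym u∈C) v∉C
  crossings-positive C (e ∷⟨ refl ⟩ w) u∈C v∉C with lookup C (hd E e) in hd∈C
  ... | true  = ≤-trans (crossings-positive C w hd∈C v∉C) (m≤n+m _ _)
  ... | false rewrite u∈C = s≤s z≤n

  module _ (C : Subset n) (closed : PredecessorClosed C) where

    crossings-outside : ∀ {u v} (w : Walk E u v) → lookup C u ≡ false → crossings C w ≡ 0
    crossings-outside []              _   = refl
    crossings-outside (e ∷⟨ refl ⟩ w) u∉C with lookup C (hd E e) in hd∈C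
    ... | true with () ← trans (sym (closed e hd∈C)) u∉C
    ... | false rewrite u∉C = crossings-outside w hd∈C

    crossings-closed : ∀ {u v} (w : Walk E u v) → lookup C u ≡ true → lookup C v ≡ false → crossings C w ≡ 1
    crossings-closed [] u∈C v∉C with () ← trans (sym u∈C) v∉C
    crossings-closed (e ∷⟨ refl ⟩ w) u∈C v∉C with lookup C (hd E e) in hd∈C
    ... | true  rewrite u∈C = crossings-closed w hd∈C v∉C
    ... | false rewrite u∈C = cong suc (crossings-outside w hd∈C)

-- Ranking by an injective key

injective⇒surjective : ∀ {n} (f : Fin n → Fin n) → (∀ {x y} → f x ≡ f y → x ≡ y) →
                       ∀ y → ∃ λ x → f x ≡ y
injective⇒surjective {suc n} f f-injective y with Fin.any? (λ x → f x Fin.≟ y)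
... | yes hit = hit
... | no miss = ⊥-elim (<-irrefl refl (Fin.injective⇒≤ squeezed-injective))
  where
  squeezed : Fin (suc n) → Fin n
  squeezed x = punchOut {i = y} {j = f x} (λ y≡fx → miss (x , sym y≡fx))
  squeezed-injective : ∀ {x x′} → squeezed x ≡ squeezed x′ → x ≡ x′
  squeezed-injective {x} {x′} = f-injective ∘ Fin.punchOut-injective {i = y} _ _

count<n : ∀ {n} (p : Fin n → Bool) v → ¬ T (p v) → ∑[ w < n ] 𝟙 (p w) < n
count<n {n} p v v∉p = subst (∑[ w < n ] 𝟙 (p w) <_) (trans (∑-const {n} 1) (*-identityʳ n))
  (∑-mono-< (𝟙≤1 ∘ p) v (subst (_< 1) (sym (𝟙-¬T v∉p)) (s≤s z≤n)))
  where
  𝟙≤1 : ∀ b → 𝟙 b ≤ 1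
  𝟙≤1 true  = s≤s z≤n
  𝟙≤1 false = z≤n

count-all-but : ∀ {n} (p : Fin n → Bool) v → ¬ T (p v) → (∀ w → w ≢ v → T (p w)) →
                suc (∑[ w < n ] 𝟙 (p w)) ≡ n
count-all-but {suc n} p zero v∉p others∈p = cong suc (begin
  𝟙 (p zero) + ∑[ w < n ] 𝟙 (p (suc w))
    ≡⟨ cong₂ _+_ (𝟙-¬T v∉p) (sum-cong-≗ (λ w → 𝟙-T (others∈p (suc w) λ ()))) ⟩
  ∑[ w < n ] 1                            ≡⟨ trans (∑-const {n} 1) (*-identityʳ n) ⟩
  n                                       ∎)
  where open ≡-Reasoning
count-all-but {suc n} p (suc v) v∉p others∈p =
  cong suc (trans (cong (_+ ∑[ w < n ] 𝟙 (p (suc w))) (𝟙-T (others∈p zero λ ())))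
                  (count-all-but (p ∘ suc) v v∉p (λ w w≢v → others∈p (suc w) (w≢v ∘ Fin.suc-injective))))

module RankBy {n} (f : Fin n → ℕ) (f-injective : ∀ {u v} → f u ≡ f v → u ≡ v) where

  rank : Fin n → ℕ
  rank v = ∑[ w < n ] 𝟙 (f v <ᵇ f w)

  rank<n : ∀ v → rank v < n
  rank<n v = count<n (λ w → f v <ᵇ f w) v (n≮n (f v) ∘ <ᵇ⇒< _ _)

  rank-anti : ∀ {u v} → f u < f v → rank v < rank u
  rank-anti {u} {v} fu<fv = ∑-mono-< (λ w → 𝟙-mono (<⇒<ᵇ ∘ <-trans fu<fv ∘ <ᵇ⇒< (f v) (f w))) v
    (subst₂ _<_ (sym (𝟙-¬T (n≮n (f v) ∘ <ᵇ⇒< _ _))) (sym (𝟙-T (<⇒<ᵇ fu<fv))) (s≤s z≤n))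

  rank-injective : ∀ {u v} → rank u ≡ rank v → u ≡ v
  rank-injective {u} {v} rank≡ with <-cmp (f u) (f v)
  ... | tri< fu<fv _ _ = ⊥-elim (<-irrefl (sym rank≡) (rank-anti fu<fv))
  ... | tri≈ _ fu≡fv _ = f-injective fu≡fv
  ... | tri> _ _ fv<fu = ⊥-elim (<-irrefl rank≡ (rank-anti fv<fu))

  rank-top : ∀ {v} → (∀ w → f w ≤ f v) → rank v ≡ 0
  rank-top {v} top =
    trans (sum-cong-≗ (λ w → 𝟙-¬T (≤⇒≯ (top w) ∘ <ᵇ⇒< _ _))) (trans (∑-const {n} 0) (*-zeroʳ n))

  rank-bottom : ∀ {v} → (∀ w → w ≢ v → f v < f w) → suc (rank v) ≡ n
  rank-bottom {v} bottom =
    count-all-but (λ w → f v <ᵇ f w) v (n≮n (f v) ∘ <ᵇ⇒< _ _) (λ w w≢v → <⇒<ᵇ (bottom w w≢v))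

  position : Fin n → Fin n
  position v = fromℕ< (rank<n v)

  position-injective : ∀ {u v} → position u ≡ position v → u ≡ v
  position-injective {u} {v} eq = rank-injective (begin
    rank u               ≡⟨ Fin.toℕ-fromℕ< (rank<n u) ⟨
    toℕ (position u)     ≡⟨ cong toℕ eq ⟩
    toℕ (position v)     ≡⟨ Fin.toℕ-fromℕ< (rank<n v) ⟩
    rank v               ∎)
    where open ≡-Reasoning

  ranking : Permutation′ n
  ranking = permutation (proj₁ ∘ onto) position (λ v → position-injective (proj₂ (onto (position v)))) (proj₂ ∘ onto)
    where
    onto : ∀ y → ∃ λ x → position x ≡ y
    onto = injective⇒surjective position position-injective

  toℕ-ranking : ∀ v → toℕ (ranking ⟨$⟩ˡ v) ≡ rank v
  toℕ-ranking v = Fin.toℕ-fromℕ< (rank<n v)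

positional-< : ∀ {n a x y} b → a < n → x < y → a + n * x < b + n * y
positional-< {n} {a} {x} {y} b a<n x<y = begin-strict
  a + n * x    <⟨ +-monoˡ-< (n * x) a<n ⟩
  n + n * x    ≡⟨ *-suc n x ⟨
  n * suc x    ≤⟨ *-monoʳ-≤ n x<y ⟩
  n * y        ≤⟨ m≤n+m (n * y) b ⟩
  b + n * y    ∎
  where open ≤-Reasoning

positional-injective : ∀ {n a b x y} → a < n → b < n → a + n * x ≡ b + n * y → a ≡ b
positional-injective {n} {a} {b} {x} {y} a<n b<n eq with <-cmp x y
... | tri< x<y _ _    = ⊥-elim (<⇒≢ (positional-< b a<n x<y) eq)
... | tri≈ _ refl _   = +-cancelʳ-≡ (n * x) a b eq
... | tri> _ _ y<x    = ⊥-elim (<⇒≢ (positional-< a b<n y<x) (sym eq))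

-- Minimally k-st-edge-connected graphs

module MinimallyConnected {n m} (E : Graph n m) {s t : Fin n} {k : ℕ} (minimal : MinimallyKStEdgeConnected E s t k) where
  open import Data.List.Membership.DecPropositional (Fin._≟_ {m}) using (_∈?_)

  path : Fin k → Walk E s t
  path i = proj₁ (proj₁ (proj₁ minimal) i)

  path-simple : ∀ i → Unique (verts E (path i))
  path-simple i = proj₂ (proj₁ (proj₁ minimal) i)

  path-edges-distinct : ∀ i → Unique (edgesOf E (path i))
  path-edges-distinct i = path-edges-unique E (path i) (path-simple i)

  paths-disjoint : EdgeDisjoint (edgesOf E ∘ path)
  paths-disjoint = proj₂ (proj₂ (proj₁ minimal))

  no-disjoint-walks-avoiding : ∀ {R e} → ¬ T (R e) → ¬ DisjointWalks E s t k R
  no-disjoint-walks-avoiding {R} {e} e∉R (W , W⊆R , disjoint) =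
    proj₂ minimal (tabulate R) (e , e∉R ∘ ∈-tabulate)
      (P , P⊆R , λ i j e′ e′∈i e′∈j → disjoint i j e′ (P⊆W i e′∈i) (P⊆W j e′∈j))
    where
    ∈-tabulate : ∀ {e} → e Subset.∈ tabulate R → T (R e)
    ∈-tabulate {e} e∈ = Equivalence.from T-≡ (trans (sym (lookup∘tabulate R e)) ([]=⇒lookup e∈))
    P : Fin k → Path E s t
    P = proj₁ ∘ shortcut E ∘ W
    P⊆W : ∀ i → edgesOf E (proj₁ (P i)) ⊆ edgesOf E (W i)
    P⊆W = proj₂ ∘ shortcut E ∘ W
    P⊆R : ∀ i e′ → e′ ∈ edgesOf E (proj₁ (P i)) → e′ Subset.∈ tabulate R
    P⊆R i e′ e′∈P =
      lookup⇒[]= e′ (tabulate R) (trans (lookup∘tabulate R e′) (Equivalence.to T-≡ (W⊆R i (P⊆W i e′∈P))))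

  every-edge-on-a-path : ∀ e → ∃ λ i → e ∈ edgesOf E (path i)
  every-edge-on-a-path e with Fin.any? (λ i → e ∈? edgesOf E (path i))
  ... | yes on-path = on-path
  ... | no  spare   = ⊥-elim (no-disjoint-walks-avoiding {R = on-path?} {e} (spare ∘ toWitness)
                               (path , (λ i e′∈i → fromWitness (i , e′∈i)) , paths-disjoint))
    where
    on-path? : Fin m → Bool
    on-path? e′ = ⌊ Fin.any? (λ i → e′ ∈? edgesOf E (path i)) ⌋

  edges-partitioned : ∀ e → ∑[ i < k ] 𝟙 (edgeSet E (path i) e) ≡ 1
  edges-partitioned e with every-edge-on-a-path e
  ... | i , e∈i = trans (∑-pointed _ i λ j j≢i → cong 𝟙 (∉⇒∈ᵇ (j≢i ∘ λ e∈j → paths-disjoint j i e e∈j e∈i)))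
                        (cong 𝟙 (∈⇒∈ᵇ e∈i))

  ∑-over-paths : ∀ g → sum g ≡ ∑[ i < k ] ∑[ e ∈ edgeSet E (path i) ] g e
  ∑-over-paths = ∑-partition (edgeSet E ∘ path) edges-partitioned

  no-edge-enters-s : ∀ e → hd E e ≢ s
  no-edge-enters-s e = let i , e∈i = every-edge-on-a-path e in path-hd≢start E (path i) (path-simple i) e∈i

  no-edge-leaves-t : ∀ e → tl E e ≢ t
  no-edge-leaves-t e = let i , e∈i = every-edge-on-a-path e in path-tl≢end E (path i) (path-simple i) e∈i

  paths-balanced : ∀ v → ∑[ e < m ] δ (tl E e) v + k * δ t v ≡ ∑[ e < m ] δ (hd E e) v + k * δ s v
  paths-balanced v = begin
    ∑[ e < m ] δ (tl E e) v + k * δ t v     ≡⟨ cong₂ _+_ (∑-over-paths _) (sym (∑-const {k} (δ t v))) ⟩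
    ∑[ i < k ] out i + ∑[ i < k ] δ t v     ≡⟨ ∑-distrib-+ out (λ _ → δ t v) ⟨
    ∑[ i < k ] (out i + δ t v)              ≡⟨ sum-cong-≗ (λ i → walk-balanced E (path i) (path-edges-distinct i) v) ⟩
    ∑[ i < k ] (in′ i + δ s v)              ≡⟨ ∑-distrib-+ in′ (λ _ → δ s v) ⟩
    ∑[ i < k ] in′ i + ∑[ i < k ] δ s v     ≡⟨ cong₂ _+_ (sym (∑-over-paths _)) (∑-const {k} (δ s v)) ⟩
    ∑[ e < m ] δ (hd E e) v + k * δ s v     ∎
    where
    open ≡-Reasoning
    out in′ : Fin k → ℕ
    out i = outdeg E (edgeSet E (path i)) v
    in′ i = indeg E (edgeSet E (path i)) v

  acyclic : ¬ Cycle E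
  acyclic (e , w) = no-disjoint-walks-avoiding {R = not ∘ edgeSet E cycle} {e} e∈cycle
                      (decompose E k (complement-balanced E {Z = edgeSet E cycle} paths-balanced cycle-balanced))
    where
    simple : Path E (hd E e) (tl E e)
    simple = proj₁ (shortcut E w)
    cycle : Walk E (tl E e) (tl E e)
    cycle = e ∷⟨ refl ⟩ proj₁ simple
    cycle-balanced : Balanced E (edgeSet E cycle) (δ (tl E e)) (δ (tl E e))
    cycle-balanced = walk-balanced E cycle
      (¬Any⇒All¬ _ (λ e∈w → path-tl≢end E (proj₁ simple) (proj₂ simple) e∈w refl)
        ∷ path-edges-unique E _ (proj₂ simple))
    e∈cycle : ¬ T (not (edgeSet E cycle e))
    e∈cycle = subst (T ∘ not) (∈⇒∈ᵇ {e = e} {edgesOf E cycle} (here refl))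

  dout-over-paths : ∀ C → dout E C ≡ ∑[ i < k ] crossings E C (path i)
  dout-over-paths C = begin
    dout E C                                                     ≡⟨ sum-map-tabulate (𝟙 ∘ leavesᵇ E C) (λ e → e) ⟩
    ∑[ e < m ] 𝟙 (leavesᵇ E C e)                                 ≡⟨ ∑-over-paths (𝟙 ∘ leavesᵇ E C) ⟩
    ∑[ i < k ] ∑[ e ∈ edgeSet E (path i) ] 𝟙 (leavesᵇ E C e)     ≡⟨ sum-cong-≗ (λ i → ∑∈-unique (path-edges-distinct i) _) ⟩
    ∑[ i < k ] crossings E C (path i)                            ∎
    where open ≡-Reasoning

  k≤dout : ∀ C → lookup C s ≡ true → lookup C t ≡ false → k ≤ dout E C
  k≤dout C s∈C t∉C = begin
    k                                  ≡⟨ trans (∑-const {k} 1) (*-identityʳ k) ⟨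
    ∑[ i < k ] 1                       ≤⟨ ∑-mono-≤ (λ i → crossings-positive E C (path i) s∈C t∉C) ⟩
    ∑[ i < k ] crossings E C (path i)  ≡⟨ dout-over-paths C ⟨
    dout E C                           ∎
    where open ≤-Reasoning

  dout-closed : ∀ C → PredecessorClosed E C → lookup C s ≡ true → lookup C t ≡ false → dout E C ≡ k
  dout-closed C closed s∈C t∉C = begin
    dout E C                           ≡⟨ dout-over-paths C ⟩
    ∑[ i < k ] crossings E C (path i)  ≡⟨ sum-cong-≗ (λ i → crossings-closed E C closed (path i) s∈C t∉C) ⟩
    ∑[ i < k ] 1                       ≡⟨ trans (∑-const {k} 1) (*-identityʳ k) ⟩
    k                                  ∎
    where open ≡-Reasoning

  closed-cut-minimum : ∀ C → PredecessorClosed E C → lookup C s ≡ true → lookup C t ≡ false →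
                       IsMinStCut E s t C × (∀ e → ¬ Enters E C e)
  closed-cut-minimum C closed s∈C t∉C = ((lookup⇒[]= s C s∈C , t∉C′) , minimum) , no-entering
    where
    t∉C′ : t Subset.∉ C
    t∉C′ t∈C with () ← trans (sym ([]=⇒lookup t∈C)) t∉C
    minimum : ∀ R → IsStCut E s t R → dout E C ≤ dout E R
    minimum R (s∈R , t∉R) = subst (_≤ dout E R) (sym (dout-closed C closed s∈C t∉C))
                                  (k≤dout R ([]=⇒lookup s∈R) (∉⇒lookup≡false R t∉R))
    no-entering : ∀ e → ¬ Enters E C e
    no-entering e (hd∈C , tl∉C) = tl∉C (lookup⇒[]= (tl E e) C (closed e ([]=⇒lookup hd∈C)))

  module Ordering (s≢t : s ≢ t) where

    -- Depth alone leaves ties (isolated vertices have depth 0 too), so s and t are put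
    -- strictly above and below every other vertex.
    level : Fin n → ℕ
    level v with v Fin.≟ s | v Fin.≟ t
    ... | yes _ | _     = suc n
    ... | no _  | yes _ = 0
    ... | no _  | no _  = suc (depth E acyclic v)

    level-s : level s ≡ suc n
    level-s with s Fin.≟ s
    ... | yes _  = refl
    ... | no s≢s = ⊥-elim (s≢s refl)

    level-t : level t ≡ 0
    level-t with t Fin.≟ s | t Fin.≟ t
    ... | yes t≡s | _      = ⊥-elim (s≢t (sym t≡s))
    ... | no _    | yes _  = refl
    ... | no _    | no t≢t = ⊥-elim (t≢t refl)

    level-inner : ∀ {v} → v ≢ s → v ≢ t → level v ≡ suc (depth E acyclic v)
    level-inner {v} v≢s v≢t with v Fin.≟ s | v Fin.≟ t
    ... | yes v≡s | _       = ⊥-elim (v≢s v≡s)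
    ... | no _    | yes v≡t = ⊥-elim (v≢t v≡t)
    ... | no _    | no _    = refl

    level<level-s : ∀ v → v ≢ s → level v < level s
    level<level-s v v≢s = case v Fin.≟ t of λ where
      (yes refl) → subst₂ _<_ (sym level-t) (sym level-s) (s≤s z≤n)
      (no v≢t)   → subst₂ _<_ (sym (level-inner v≢s v≢t)) (sym level-s) (s≤s (depth<n E acyclic v))

    level-t<level : ∀ v → v ≢ t → level t < level v
    level-t<level v v≢t = case v Fin.≟ s of λ where
      (yes refl) → subst₂ _<_ (sym level-t) (sym level-s) (s≤s z≤n)
      (no v≢s)   → subst₂ _<_ (sym level-t) (sym (level-inner v≢s v≢t)) (s≤s z≤n)

    level-decreasing : ∀ e → level (hd E e) < level (tl E e)
    level-decreasing e = case ((tl E e Fin.≟ s) , (hd E e Fin.≟ t)) of λ where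
      (yes tl≡s , _)      → subst (λ x → level (hd E e) < level x) (sym tl≡s) (level<level-s (hd E e) (no-edge-enters-s e))
      (no _ , yes hd≡t)   → subst (λ x → level x < level (tl E e)) (sym hd≡t) (level-t<level (tl E e) (no-edge-leaves-t e))
      (no tl≢s , no hd≢t) →
        subst₂ _<_ (sym (level-inner (no-edge-enters-s e) hd≢t)) (sym (level-inner tl≢s (no-edge-leaves-t e)))
               (s≤s (depth-decreasing E acyclic e))

    -- Lexicographic in (level, index), hence injective.
    potential : Fin n → ℕ
    potential v = toℕ v + n * level v

    potential-injective : ∀ {u v} → potential u ≡ potential v → u ≡ v
    potential-injective {u} {v} = Fin.toℕ-injective ∘ positional-injective (Fin.toℕ<n u) (Fin.toℕ<n v)

    potential-< : ∀ {u v} → level u < level v → potential u < potential v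
    potential-< {u} {v} = positional-< (toℕ v) (Fin.toℕ<n u)

    open RankBy potential potential-injective public

    in-prefix : ∀ i v → lookup (prefix ranking i) v ≡ (rank v <ᵇ i)
    in-prefix i v = trans (lookup∘tabulate _ v) (cong (_<ᵇ i) (toℕ-ranking v))

    rank-s : rank s ≡ 0
    rank-s = rank-top λ w → case w Fin.≟ s of λ where
      (yes refl) → ≤-refl
      (no w≢s)   → <⇒≤ (potential-< (level<level-s w w≢s))

    rank-t : suc (rank t) ≡ n
    rank-t = rank-bottom λ w w≢t → potential-< (level-t<level w w≢t)

    prefix-closed : ∀ i → PredecessorClosed E (prefix ranking i)
    prefix-closed i e hd∈C = trans (in-prefix i (tl E e)) (Equivalence.to T-≡ (<⇒<ᵇ (<-trans tl<hd hd<i)))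
      where
      tl<hd : rank (tl E e) < rank (hd E e)
      tl<hd = rank-anti (potential-< (level-decreasing e))
      hd<i : rank (hd E e) < i
      hd<i = <ᵇ⇒< _ i (Equivalence.from T-≡ (trans (sym (in-prefix i (hd E e))) hd∈C))

    s∈prefix : ∀ {i} → 1 ≤ i → lookup (prefix ranking i) s ≡ true
    s∈prefix {i} 1≤i = trans (in-prefix i s) (Equivalence.to T-≡ (<⇒<ᵇ (subst (_< i) (sym rank-s) 1≤i)))

    t∉prefix : ∀ {i} → suc i ≤ n → lookup (prefix ranking i) t ≡ false
    t∉prefix {i} 1+i≤n = trans (in-prefix i t) (¬T⇒≡false (≤⇒≯ i≤rank-t ∘ <ᵇ⇒< (rank t) i))
      where
      i≤rank-t : i ≤ rank t
      i≤rank-t = s≤s⁻¹ (subst (suc i ≤_) (sym rank-t) 1+i≤n)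

lemma2 : ∀ {n m : ℕ} (E : Graph n m) (s t : Fin n) (k : ℕ) → s ≢ t →
  MinimallyKStEdgeConnected E s t k →
  Σ (Permutation′ n) λ π →
    toℕ (π ⟨$⟩ˡ s) ≡ 0 × suc (toℕ (π ⟨$⟩ˡ t)) ≡ n ×
    (∀ i → 1 ≤ i → suc i ≤ n →
      IsMinStCut E s t (prefix π i) × (∀ e → ¬ Enters E (prefix π i) e))
lemma2 E s t k s≢t minimal =
  ranking , trans (toℕ-ranking s) rank-s , trans (cong suc (toℕ-ranking t)) rank-t ,
  λ i 1≤i 1+i≤n → closed-cut-minimum (prefix ranking i) (prefix-closed i) (s∈prefix 1≤i) (t∉prefix 1+i≤n)
  where
  open MinimallyConnected E minimal
  open Ordering s≢t
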